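{- In the table with $5$ rows, for all $s,t\ge1$: \[\mathcal{D}(s,1)\,\mathcal{D}(s+t,3)-\mathcal{D}(s,3)\,\mathcal{D}(s+t,1)=\sum_{i=s}^{s+t-1}\mathcal{D}(i,2).\]
   Context: For $m\ge1$, $s\ge1$, $1\le t\le m$, $\mathcal{D}(s,t)$ (in the table with $m$ rows; here $m=5$) is the number of sequences $(r_1,\dots,r_s)$ with $r_i\in\{1,\dots,m\}$, $|r_{i+1}-r_i|\le1$ and $r_s=t$, i.e. the number of lattice paths with steps $(1,0),(1,1),(1,-1)$ from any cell of the first column to the cell in column $s$, row $t$, staying inside the table. -}

module Defs where

open import Data.Nat using (ℕ; zero; suc; _+_; _∸_; _≤ᵇ_; _≡ᵇ_)
open import Data.Bool using (Bool; true; false; _∧_)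
open import Data.List using (List; []; _∷_; map; concatMap; filter; length; upTo; sum; applyUpTo)
open import Relation.Nullary.Decidable using (Dec)
open import Data.Bool.Properties using (T?)

allSeqs : ℕ → ℕ → List (List ℕ)
allSeqs m zero = [] ∷ []
allSeqs m (suc s) =
  concatMap (λ r → map (λ rs → r ∷ rs) (allSeqs m s)) (applyUpTo suc m)

close : ℕ → ℕ → Bool
close a b = ((a ∸ b) ≤ᵇ 1) ∧ ((b ∸ a) ≤ᵇ 1)

adjOK : List ℕ → Bool
adjOK [] = true
adjOK (a ∷ []) = true
adjOK (a ∷ b ∷ rs) = close a b ∧ adjOK (b ∷ rs)

lastIs : ℕ → List ℕ → Bool
lastIs t [] = false
lastIs t (a ∷ []) = a ≡ᵇ t
lastIs t (a ∷ b ∷ rs) = lastIs t (b ∷ rs)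

valid : ℕ → List ℕ → Bool
valid t rs = adjOK rs ∧ lastIs t rs

𝒟 : ℕ → ℕ → ℕ → ℕ
𝒟 m s t = length (filter (λ rs → T? (valid t rs)) (allSeqs m s))

sumFrom : ℕ → ℕ → (ℕ → ℕ) → ℕ
sumFrom a zero f = 0
sumFrom a (suc n) f = f a + sumFrom (suc a) n f

-- Let W_s(r, t) be the number of walks of s steps from row r to row t, so that 𝒟(s+1, t) = Σ_r W_s(r, t).
-- Splitting off the first step gives W_{s+1} = A W_s for the adjacency matrix A of the path on the rows,
-- hence W_s = A^s and, by associativity, also W_{s+1} = W_s A, i.e. 𝒟(s+2, ·) = 𝒟(s+1, ·) A. For five rows
-- this recurrence preserves the symmetry 𝒟(s,1) = 𝒟(s,5), 𝒟(s,2) = 𝒟(s,4) and the invariant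
-- 2 𝒟(s,1) = 𝒟(s,3) + 1; with them, increasing t by one adds exactly the term 𝒟(s+t,2) to the left-hand side.
module Submission where

open import Defs
open import Data.Nat using (ℕ; _+_; _≥_)
open import Data.Integer using (ℤ; +_; _-_; _*_)
open import Relation.Binary.PropositionalEquality using (_≡_)

import Data.Nat as ℕ
open import Data.Nat using (zero; suc; _∸_; _≡ᵇ_; s≤s)
open import Data.Nat.Properties
  using (+-identityʳ; +-assoc; +-comm; +-suc; *-identityˡ; *-assoc; *-comm; *-zeroʳ;
         *-distribˡ-+; *-distribʳ-+; <⇒≢; m≤m+n; m+n∸m≡n; +-commutativeSemigroup)
open import Data.Nat.Tactic.RingSolver using (solve-∀)
open import Algebra.Properties.CommutativeSemigroup +-commutativeSemigroup using (interchange)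
open import Data.Integer using (_⊖_)
open import Data.Integer.Properties using (pos-*; [+m]-[+n]≡m⊖n; ⊖-≥)
open import Data.Empty using (⊥-elim)
open import Data.Bool using (Bool; true; false; if_then_else_)
open import Data.Bool.Properties using (T?)
open import Data.Product using (_×_; _,_; proj₂)
open import Data.List using (List; []; _∷_; _++_; map; concatMap; filter; length; applyUpTo)
open import Data.List.Membership.Propositional using (_∈_)
open import Data.List.Relation.Unary.Any using (here; there)
import Data.List.Relation.Unary.All as All
open import Data.List.Relation.Unary.AllPairs using (_∷_)
open import Data.List.Relation.Unary.Unique.Propositional using (Unique)
open import Data.List.Relation.Unary.Unique.Propositional.Properties using (applyUpTo⁺₁)
open import Function using (_∘_)
open import Relation.Binary.PropositionalEquality
  using (refl; sym; trans; cong; cong₂; _≢_; ≢-sym; module ≡-Reasoning)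
open ≡-Reasoning

private
  variable
    A B : Set
    f g : A → ℕ

∑ : List A → (A → ℕ) → ℕ
∑ []       f = 0
∑ (x ∷ xs) f = f x + ∑ xs f

infix 5 ∑
syntax ∑ xs (λ x → e) = ∑[ x ∈ xs ] e

∑-cong : ∀ (xs : List A) → (∀ {x} → x ∈ xs → f x ≡ g x) → ∑ xs f ≡ ∑ xs g
∑-cong []       eq = refl
∑-cong (x ∷ xs) eq = cong₂ _+_ (eq (here refl)) (∑-cong xs (eq ∘ there))

∑-zero : ∀ (xs : List A) → (∀ {x} → x ∈ xs → f x ≡ 0) → ∑ xs f ≡ 0
∑-zero []       eq = refl
∑-zero (x ∷ xs) eq = cong₂ _+_ (eq (here refl)) (∑-zero xs (eq ∘ there))

∑-++ : ∀ (xs ys : List A) → ∑ (xs ++ ys) f ≡ ∑ xs f + ∑ ys f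
∑-++ [] ys = refl
∑-++ {f = f} (x ∷ xs) ys = trans (cong (_+_ (f x)) (∑-++ xs ys)) (sym (+-assoc (f x) _ _))

∑-map : ∀ (g : A → B) (xs : List A) → ∑ (map g xs) f ≡ ∑[ x ∈ xs ] f (g x)
∑-map g [] = refl
∑-map {f = f} g (x ∷ xs) = cong (_+_ (f (g x))) (∑-map g xs)

∑-concatMap : ∀ (g : A → List B) (xs : List A) → ∑ (concatMap g xs) f ≡ ∑[ x ∈ xs ] ∑ (g x) f
∑-concatMap g [] = refl
∑-concatMap {f = f} g (x ∷ xs) =
  trans (∑-++ (g x) (concatMap g xs)) (cong (_+_ (∑ (g x) f)) (∑-concatMap g xs))

∑-distrib-+ : ∀ (xs : List A) → ∑[ x ∈ xs ] (f x + g x) ≡ ∑ xs f + ∑ xs g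
∑-distrib-+ [] = refl
∑-distrib-+ {f = f} {g} (x ∷ xs) =
  trans (cong (_+_ (f x + g x)) (∑-distrib-+ xs)) (interchange (f x) (g x) (∑ xs f) (∑ xs g))

∑-comm : ∀ (xs : List A) (ys : List B) (F : A → B → ℕ) →
         ∑[ x ∈ xs ] ∑[ y ∈ ys ] F x y ≡ ∑[ y ∈ ys ] ∑[ x ∈ xs ] F x y
∑-comm []       ys F = sym (∑-zero ys (λ _ → refl))
∑-comm (x ∷ xs) ys F = trans (cong (_+_ (∑ ys (F x))) (∑-comm xs ys F)) (sym (∑-distrib-+ ys))

*-distribˡ-∑ : ∀ k (xs : List A) → k ℕ.* (∑ xs f) ≡ ∑[ x ∈ xs ] k ℕ.* f x
*-distribˡ-∑ k [] = *-zeroʳ k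
*-distribˡ-∑ {f = f} k (x ∷ xs) =
  trans (*-distribˡ-+ k (f x) (∑ xs f)) (cong (_+_ (k ℕ.* f x)) (*-distribˡ-∑ k xs))

*-distribʳ-∑ : ∀ k (xs : List A) → (∑ xs f) ℕ.* k ≡ ∑[ x ∈ xs ] f x ℕ.* k
*-distribʳ-∑ k [] = refl
*-distribʳ-∑ {f = f} k (x ∷ xs) =
  trans (*-distribʳ-+ k (f x) (∑ xs f)) (cong (_+_ (f x ℕ.* k)) (*-distribʳ-∑ k xs))

∑-comm-*ʳ : ∀ (xs : List A) (ys : List B) (F : A → B → ℕ) (c : B → ℕ) →
            ∑[ x ∈ xs ] ∑[ y ∈ ys ] F x y ℕ.* c y ≡ ∑[ y ∈ ys ] (∑[ x ∈ xs ] F x y) ℕ.* c y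
∑-comm-*ʳ xs ys F c =
  trans (∑-comm xs ys _) (∑-cong ys (λ {y} _ → sym (*-distribʳ-∑ (c y) xs)))

𝟙 : Bool → ℕ
𝟙 b = if b then 1 else 0

length-filter-T? : ∀ (p : A → Bool) xs → length (filter (λ x → T? (p x)) xs) ≡ ∑[ x ∈ xs ] 𝟙 (p x)
length-filter-T? p []       = refl
length-filter-T? p (x ∷ xs) with p x
... | true  = cong suc (length-filter-T? p xs)
... | false = length-filter-T? p xs

δ : ℕ → ℕ → ℕ
δ x y = 𝟙 (x ≡ᵇ y)

δ-refl : ∀ x → δ x x ≡ 1
δ-refl zero    = refl
δ-refl (suc x) = δ-refl x

δ-≢ : ∀ {x y} → x ≢ y → δ x y ≡ 0
δ-≢ {zero}  {zero}  x≢y = ⊥-elim (x≢y refl)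
δ-≢ {zero}  {suc y} x≢y = refl
δ-≢ {suc x} {zero}  x≢y = refl
δ-≢ {suc x} {suc y} x≢y = δ-≢ (x≢y ∘ cong suc)

δ-sym : ∀ x y → δ x y ≡ δ y x
δ-sym zero    zero    = refl
δ-sym zero    (suc y) = refl
δ-sym (suc x) zero    = refl
δ-sym (suc x) (suc y) = δ-sym x y

∑-δ : ∀ {xs y} (f : ℕ → ℕ) → Unique xs → y ∈ xs → ∑[ x ∈ xs ] δ y x ℕ.* f x ≡ f y
∑-δ {x ∷ xs} f (x∉xs ∷ _) (here refl) = begin
  δ x x ℕ.* f x + (∑[ x′ ∈ xs ] δ x x′ ℕ.* f x′)
    ≡⟨ cong₂ _+_ (cong (ℕ._* f x) (δ-refl x))
                 (∑-zero xs (λ x′∈xs → cong (ℕ._* _) (δ-≢ (All.lookup x∉xs x′∈xs)))) ⟩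
  1 ℕ.* f x + 0
    ≡⟨ trans (+-identityʳ _) (*-identityˡ (f x)) ⟩
  f x ∎
∑-δ {x ∷ xs} f (x∉xs ∷ unique) (there y∈xs) =
  cong₂ _+_ (cong (ℕ._* f x) (δ-≢ (≢-sym (All.lookup x∉xs y∈xs)))) (∑-δ f unique y∈xs)

rows : ℕ → List ℕ
rows m = applyUpTo suc m

rows-unique : ∀ m → Unique (rows m)
rows-unique m = applyUpTo⁺₁ suc m (λ i<j _ → <⇒≢ (s≤s i<j))

adj : ℕ → ℕ → ℕ
adj a b = 𝟙 (close a b)

walks : ℕ → ℕ → ℕ → ℕ → ℕ
walks m s r t = ∑[ rs ∈ allSeqs m s ] 𝟙 (valid t (r ∷ rs))

walks-zero : ∀ m r t → walks m 0 r t ≡ δ r t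
walks-zero m r t = +-identityʳ (δ r t)

valid-∷ : ∀ t r r′ rs → 𝟙 (valid t (r ∷ r′ ∷ rs)) ≡ adj r r′ ℕ.* 𝟙 (valid t (r′ ∷ rs))
valid-∷ t r r′ rs with close r r′
... | true  = sym (*-identityˡ _)
... | false = refl

𝒟≡∑walks : ∀ m s t → 𝒟 m (suc s) t ≡ ∑[ r ∈ rows m ] walks m s r t
𝒟≡∑walks m s t = begin
  𝒟 m (suc s) t
    ≡⟨ length-filter-T? (valid t) (allSeqs m (suc s)) ⟩
  ∑[ rs ∈ allSeqs m (suc s) ] 𝟙 (valid t rs)
    ≡⟨ ∑-concatMap (λ r → map (r ∷_) (allSeqs m s)) (rows m) ⟩
  ∑[ r ∈ rows m ] ∑[ rs ∈ map (r ∷_) (allSeqs m s) ] 𝟙 (valid t rs)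
    ≡⟨ ∑-cong (rows m) (λ {r} _ → ∑-map (r ∷_) (allSeqs m s)) ⟩
  ∑[ r ∈ rows m ] walks m s r t ∎

walks-sucˡ : ∀ m s r t → walks m (suc s) r t ≡ ∑[ r′ ∈ rows m ] adj r r′ ℕ.* walks m s r′ t
walks-sucˡ m s r t = begin
  walks m (suc s) r t
    ≡⟨ ∑-concatMap (λ r′ → map (r′ ∷_) (allSeqs m s)) (rows m) ⟩
  ∑[ r′ ∈ rows m ] ∑[ rs ∈ map (r′ ∷_) (allSeqs m s) ] 𝟙 (valid t (r ∷ rs))
    ≡⟨ ∑-cong (rows m) (λ {r′} _ → trans (∑-map (r′ ∷_) (allSeqs m s)) (first-step r′)) ⟩
  ∑[ r′ ∈ rows m ] adj r r′ ℕ.* walks m s r′ t ∎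
  where
  first-step : ∀ r′ → ∑[ rs ∈ allSeqs m s ] 𝟙 (valid t (r ∷ r′ ∷ rs)) ≡ adj r r′ ℕ.* walks m s r′ t
  first-step r′ = trans (∑-cong (allSeqs m s) (λ {rs} _ → valid-∷ t r r′ rs))
                        (sym (*-distribˡ-∑ (adj r r′) (allSeqs m s)))

walks-sucʳ : ∀ m s {r t} → r ∈ rows m → t ∈ rows m →
             walks m (suc s) r t ≡ ∑[ t′ ∈ rows m ] walks m s r t′ ℕ.* adj t′ t
walks-sucʳ m zero {r} {t} r∈rows t∈rows = begin
  walks m 1 r t
    ≡⟨ walks-sucˡ m 0 r t ⟩
  ∑[ r′ ∈ rows m ] adj r r′ ℕ.* walks m 0 r′ t
    ≡⟨ ∑-cong (rows m) (λ {r′} _ → as-δ r′) ⟩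
  ∑[ r′ ∈ rows m ] δ t r′ ℕ.* adj r r′
    ≡⟨ ∑-δ (adj r) (rows-unique m) t∈rows ⟩
  adj r t
    ≡⟨ sym (∑-δ (λ t′ → adj t′ t) (rows-unique m) r∈rows) ⟩
  ∑[ t′ ∈ rows m ] δ r t′ ℕ.* adj t′ t
    ≡⟨ ∑-cong (rows m) (λ {t′} _ → cong (ℕ._* adj t′ t) (sym (walks-zero m r t′))) ⟩
  ∑[ t′ ∈ rows m ] walks m 0 r t′ ℕ.* adj t′ t ∎
  where
  as-δ : ∀ r′ → adj r r′ ℕ.* walks m 0 r′ t ≡ δ t r′ ℕ.* adj r r′
  as-δ r′ = trans (cong (adj r r′ ℕ.*_) (trans (walks-zero m r′ t) (δ-sym r′ t))) (*-comm (adj r r′) (δ t r′))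
walks-sucʳ m (suc s) {r} {t} r∈rows t∈rows = begin
  walks m (2 + s) r t
    ≡⟨ walks-sucˡ m (suc s) r t ⟩
  ∑[ r′ ∈ rows m ] adj r r′ ℕ.* walks m (suc s) r′ t
    ≡⟨ ∑-cong (rows m) (λ {r′} r′∈rows → reassociate r′ (walks-sucʳ m s r′∈rows t∈rows)) ⟩
  ∑[ r′ ∈ rows m ] ∑[ t′ ∈ rows m ] adj r r′ ℕ.* walks m s r′ t′ ℕ.* adj t′ t
    ≡⟨ ∑-comm-*ʳ (rows m) (rows m) _ (λ t′ → adj t′ t) ⟩
  ∑[ t′ ∈ rows m ] (∑[ r′ ∈ rows m ] adj r r′ ℕ.* walks m s r′ t′) ℕ.* adj t′ t
    ≡⟨ ∑-cong (rows m) (λ {t′} _ → cong (ℕ._* adj t′ t) (sym (walks-sucˡ m s r t′))) ⟩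
  ∑[ t′ ∈ rows m ] walks m (suc s) r t′ ℕ.* adj t′ t ∎
  where
  reassociate : ∀ r′ → walks m (suc s) r′ t ≡ ∑[ t′ ∈ rows m ] walks m s r′ t′ ℕ.* adj t′ t →
                adj r r′ ℕ.* walks m (suc s) r′ t ≡ ∑[ t′ ∈ rows m ] adj r r′ ℕ.* walks m s r′ t′ ℕ.* adj t′ t
  reassociate r′ eq = trans (cong (adj r r′ ℕ.*_) eq)
    (trans (*-distribˡ-∑ (adj r r′) (rows m))
           (∑-cong (rows m) (λ {t′} _ → sym (*-assoc (adj r r′) (walks m s r′ t′) (adj t′ t)))))

𝒟-recurrence : ∀ m s {t} → t ∈ rows m →
               𝒟 m (2 + s) t ≡ ∑[ t′ ∈ rows m ] 𝒟 m (suc s) t′ ℕ.* adj t′ t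
𝒟-recurrence m s {t} t∈rows = begin
  𝒟 m (2 + s) t
    ≡⟨ 𝒟≡∑walks m (suc s) t ⟩
  ∑[ r ∈ rows m ] walks m (suc s) r t
    ≡⟨ ∑-cong (rows m) (λ r∈rows → walks-sucʳ m s r∈rows t∈rows) ⟩
  ∑[ r ∈ rows m ] ∑[ t′ ∈ rows m ] walks m s r t′ ℕ.* adj t′ t
    ≡⟨ ∑-comm-*ʳ (rows m) (rows m) (walks m s) (λ t′ → adj t′ t) ⟩
  ∑[ t′ ∈ rows m ] (∑[ r ∈ rows m ] walks m s r t′) ℕ.* adj t′ t
    ≡⟨ ∑-cong (rows m) (λ {t′} _ → cong (ℕ._* adj t′ t) (sym (𝒟≡∑walks m s t′))) ⟩
  ∑[ t′ ∈ rows m ] 𝒟 m (suc s) t′ ℕ.* adj t′ t ∎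

d : ℕ → ℕ → ℕ
d s t = 𝒟 5 (suc s) t

d-suc-1 : ∀ s → d (suc s) 1 ≡ d s 1 + d s 2
d-suc-1 s = trans (𝒟-recurrence 5 s (here refl))
                  (row-sum (d s 1) (d s 2) (d s 3) (d s 4) (d s 5))
  where
  row-sum : ∀ a b c e f → a ℕ.* 1 + (b ℕ.* 1 + (c ℕ.* 0 + (e ℕ.* 0 + (f ℕ.* 0 + 0)))) ≡ a + b
  row-sum = solve-∀

d-suc-2 : ∀ s → d (suc s) 2 ≡ d s 1 + d s 2 + d s 3
d-suc-2 s = trans (𝒟-recurrence 5 s (there (here refl)))
                  (row-sum (d s 1) (d s 2) (d s 3) (d s 4) (d s 5))
  where
  row-sum : ∀ a b c e f → a ℕ.* 1 + (b ℕ.* 1 + (c ℕ.* 1 + (e ℕ.* 0 + (f ℕ.* 0 + 0)))) ≡ a + b + c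
  row-sum = solve-∀

d-suc-3 : ∀ s → d (suc s) 3 ≡ d s 2 + d s 3 + d s 4
d-suc-3 s = trans (𝒟-recurrence 5 s (there (there (here refl))))
                  (row-sum (d s 1) (d s 2) (d s 3) (d s 4) (d s 5))
  where
  row-sum : ∀ a b c e f → a ℕ.* 0 + (b ℕ.* 1 + (c ℕ.* 1 + (e ℕ.* 1 + (f ℕ.* 0 + 0)))) ≡ b + c + e
  row-sum = solve-∀

d-suc-4 : ∀ s → d (suc s) 4 ≡ d s 3 + d s 4 + d s 5
d-suc-4 s = trans (𝒟-recurrence 5 s (there (there (there (here refl)))))
                  (row-sum (d s 1) (d s 2) (d s 3) (d s 4) (d s 5))
  where
  row-sum : ∀ a b c e f → a ℕ.* 0 + (b ℕ.* 0 + (c ℕ.* 1 + (e ℕ.* 1 + (f ℕ.* 1 + 0)))) ≡ c + e + f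
  row-sum = solve-∀

d-suc-5 : ∀ s → d (suc s) 5 ≡ d s 4 + d s 5
d-suc-5 s = trans (𝒟-recurrence 5 s (there (there (there (there (here refl))))))
                  (row-sum (d s 1) (d s 2) (d s 3) (d s 4) (d s 5))
  where
  row-sum : ∀ a b c e f → a ℕ.* 0 + (b ℕ.* 0 + (c ℕ.* 0 + (e ℕ.* 1 + (f ℕ.* 1 + 0)))) ≡ e + f
  row-sum = solve-∀

d-reflect : ∀ s → d s 1 ≡ d s 5 × d s 2 ≡ d s 4
d-reflect zero    = refl , refl
d-reflect (suc s) with d-reflect s
... | d₁≡d₅ , d₂≡d₄ = outer , inner
  where
  outer : d (suc s) 1 ≡ d (suc s) 5
  outer = begin
    d (suc s) 1       ≡⟨ d-suc-1 s ⟩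
    d s 1 + d s 2     ≡⟨ cong₂ _+_ d₁≡d₅ d₂≡d₄ ⟩
    d s 5 + d s 4     ≡⟨ +-comm (d s 5) (d s 4) ⟩
    d s 4 + d s 5     ≡⟨ d-suc-5 s ⟨
    d (suc s) 5       ∎
  inner : d (suc s) 2 ≡ d (suc s) 4
  inner = begin
    d (suc s) 2               ≡⟨ d-suc-2 s ⟩
    d s 1 + d s 2 + d s 3     ≡⟨ cong₂ (λ x y → x + y + d s 3) d₁≡d₅ d₂≡d₄ ⟩
    d s 5 + d s 4 + d s 3     ≡⟨ reverse (d s 5) (d s 4) (d s 3) ⟩
    d s 3 + d s 4 + d s 5     ≡⟨ d-suc-4 s ⟨
    d (suc s) 4               ∎
    where
    reverse : ∀ a b c → a + b + c ≡ c + b + a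
    reverse = solve-∀

d-suc-3′ : ∀ s → d (suc s) 3 ≡ 2 ℕ.* d s 2 + d s 3
d-suc-3′ s = begin
  d (suc s) 3              ≡⟨ d-suc-3 s ⟩
  d s 2 + d s 3 + d s 4    ≡⟨ cong (_+_ (d s 2 + d s 3)) (proj₂ (d-reflect s)) ⟨
  d s 2 + d s 3 + d s 2    ≡⟨ collect (d s 2) (d s 3) ⟩
  2 ℕ.* d s 2 + d s 3      ∎
  where
  collect : ∀ b c → b + c + b ≡ 2 ℕ.* b + c
  collect = solve-∀

2*d₁≡d₃+1 : ∀ s → 2 ℕ.* d s 1 ≡ d s 3 + 1
2*d₁≡d₃+1 zero    = refl
2*d₁≡d₃+1 (suc s) = begin
  2 ℕ.* d (suc s) 1            ≡⟨ cong (2 ℕ.*_) (d-suc-1 s) ⟩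
  2 ℕ.* (d s 1 + d s 2)        ≡⟨ *-distribˡ-+ 2 (d s 1) (d s 2) ⟩
  2 ℕ.* d s 1 + 2 ℕ.* d s 2    ≡⟨ cong (λ x → x + 2 ℕ.* d s 2) (2*d₁≡d₃+1 s) ⟩
  d s 3 + 1 + 2 ℕ.* d s 2      ≡⟨ rearrange (d s 3) (2 ℕ.* d s 2) ⟩
  2 ℕ.* d s 2 + d s 3 + 1      ≡⟨ cong (λ x → x + 1) (d-suc-3′ s) ⟨
  d (suc s) 3 + 1              ∎
  where
  rearrange : ∀ c b → c + 1 + b ≡ b + c + 1
  rearrange = solve-∀

sumFrom-snoc : ∀ a n (f : ℕ → ℕ) → sumFrom a (suc n) f ≡ sumFrom a n f + f (a + n)
sumFrom-snoc a zero    f = trans (+-identityʳ (f a)) (cong f (sym (+-identityʳ a)))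
sumFrom-snoc a (suc n) f = begin
  f a + sumFrom (suc a) (suc n) f                 ≡⟨ cong (_+_ (f a)) (sumFrom-snoc (suc a) n f) ⟩
  f a + (sumFrom (suc a) n f + f (suc a + n))     ≡⟨ +-assoc (f a) _ _ ⟨
  f a + sumFrom (suc a) n f + f (suc (a + n))     ≡⟨ cong (λ i → f a + sumFrom (suc a) n f + f i) (+-suc a n) ⟨
  f a + sumFrom (suc a) n f + f (a + suc n)       ∎

d-cassini : ∀ s k → d s 1 ℕ.* d (s + k) 3 ≡ d s 3 ℕ.* d (s + k) 1 + sumFrom (suc s) k (λ i → 𝒟 5 i 2)
d-cassini s zero    rewrite +-identityʳ s = trans (*-comm (d s 1) (d s 3)) (sym (+-identityʳ _))
d-cassini s (suc k) rewrite +-suc s k = begin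
  d s 1 ℕ.* d (suc n) 3
    ≡⟨ cong (d s 1 ℕ.*_) (d-suc-3′ n) ⟩
  d s 1 ℕ.* (2 ℕ.* d n 2 + d n 3)
    ≡⟨ expand (d s 1) (d n 2) (d n 3) ⟩
  2 ℕ.* d s 1 ℕ.* d n 2 + d s 1 ℕ.* d n 3
    ≡⟨ cong₂ (λ x y → x ℕ.* d n 2 + y) (2*d₁≡d₃+1 s) (d-cassini s k) ⟩
  (d s 3 + 1) ℕ.* d n 2 + (d s 3 ℕ.* d n 1 + S)
    ≡⟨ regroup (d s 3) (d n 1) (d n 2) S ⟩
  d s 3 ℕ.* (d n 1 + d n 2) + (S + d n 2)
    ≡⟨ cong₂ (λ x y → d s 3 ℕ.* x + y) (d-suc-1 n) (sumFrom-snoc (suc s) k _) ⟨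
  d s 3 ℕ.* d (suc n) 1 + sumFrom (suc s) (suc k) (λ i → 𝒟 5 i 2) ∎
  where
  n = s + k
  S = sumFrom (suc s) k (λ i → 𝒟 5 i 2)
  expand : ∀ a b c → a ℕ.* (2 ℕ.* b + c) ≡ 2 ℕ.* a ℕ.* b + a ℕ.* c
  expand = solve-∀
  regroup : ∀ c a b S → (c + 1) ℕ.* b + (c ℕ.* a + S) ≡ c ℕ.* (a + b) + (S + b)
  regroup = solve-∀

m≡n+o⇒+m-+n≡+o : ∀ {m n o} → m ≡ n + o → + m - + n ≡ + o
m≡n+o⇒+m-+n≡+o {n = n} {o} refl = begin
  + (n + o) - + n     ≡⟨ [+m]-[+n]≡m⊖n (n + o) n ⟩
  (n + o) ⊖ n         ≡⟨ ⊖-≥ (m≤m+n n o) ⟩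
  + (n + o ∸ n)       ≡⟨ cong +_ (m+n∸m≡n n o) ⟩
  + o                 ∎

proposition4p2 : ∀ (s t : ℕ) → s ≥ 1 → t ≥ 1 →
    (+ 𝒟 5 s 1) * (+ 𝒟 5 (s + t) 3) - (+ 𝒟 5 s 3) * (+ 𝒟 5 (s + t) 1)
      ≡ + sumFrom s t (λ i → 𝒟 5 i 2)
proposition4p2 (suc s) t _ _ = begin
  + d s 1 * + d (s + t) 3 - + d s 3 * + d (s + t) 1
    ≡⟨ cong₂ _-_ (pos-* (d s 1) _) (pos-* (d s 3) _) ⟨
  + (d s 1 ℕ.* d (s + t) 3) - + (d s 3 ℕ.* d (s + t) 1)
    ≡⟨ m≡n+o⇒+m-+n≡+o (d-cassini s t) ⟩
  + sumFrom (suc s) t (λ i → 𝒟 5 i 2) ∎
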